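{- Let $v$ be a positive even integer and let $(A,B)$ be a periodic Golay pair of length $v$, with $a=\sum_i a_i$ and $b=\sum_i b_i$ the sums of the entries of $A$ and $B$. Suppose that either no prime $p\equiv 1\pmod 4$ divides $v/2$, or exactly one prime $p\equiv1\pmod 4$ divides $v/2$ and it divides $v/2$ exactly once ($p\,\|\,v/2$). Then the $(v/2)$-compression $(A^{(v/2)},B^{(v/2)})$ of $(A,B)$ is equivalent to either $([0,a],[0,b])$ or $\bigl([\tfrac{a+b}{2},\tfrac{a-b}{2}],[\tfrac{a+b}{2},\tfrac{b-a}{2}]\bigr)$.
   Context: A periodic Golay pair of length $v$ is a pair of sequences $A=[a_0,\dots,a_{v-1}]$, $B=[b_0,\dots,b_{v-1}]$ with all entries in $\{ -1,+1\}$ such that $\mathrm{PAF}(A,s)+\mathrm{PAF}(B,s)=0$ for $s=1,\dots,v/2$, where $\mathrm{PAF}(A,s)=\sum_{k=0}^{v-1}a_ka_{k+s}$ with indices modulo $v$. For a positive divisor $m$ of $v$, the $m$-compression of $A$ is the length-$v/m$ sequence $A^{(m)}$ with entries $a^{(m)}_k=\sum_{j=0}^{m-1}a_{k+j\,v/m}$; the $m$-compression of $(A,B)$ is $(A^{(m)},B^{(m)})$. Equivalence of pairs $(X,Y)$ of integer sequences of a common length $n$ is the equivalence relation generated by the operations: swapping $X$ and $Y$; cyclically shifting the entries of one of the sequences; reversing one of the sequences; decimation, replacing $x_i$ by $x_{ki \bmod n}$ and $y_i$ by $y_{ki\bmod n}$ for some $k$ coprime to $n$; alternating negation, replacing $x_i$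 by $(-1)^ix_i$ and $y_i$ by $(-1)^iy_i$ (the negation of one sequence is obtainable from these). -}

module Defs where

open import Data.Nat as ℕ using (ℕ; zero; suc; NonZero)
open import Data.Nat.DivMod using (_%_; m%n<n)
open import Data.Nat.Coprimality using (Coprime)
import Data.Fin as Fin
open Fin using (Fin; toℕ; fromℕ<)
open import Data.Integer using (ℤ; +_; -_; _+_; _*_; _/ℕ_)
open import Data.Product using (_×_; _,_)
open import Relation.Binary.PropositionalEquality using (_≡_)
open import Relation.Binary.Construct.Closure.Equivalence using (EqClosure)
open import Data.Sum using (_⊎_)

Seq : ℕ → Set
Seq n = Fin n → ℤ

at : {n : ℕ} .{{_ : NonZero n}} → Seq n → ℕ → ℤ
at {n} X i = X (fromℕ< (m%n<n i n))

sumTo : ℕ → (ℕ → ℤ) → ℤ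
sumTo zero f = + 0
sumTo (suc n) f = sumTo n f + f n

total : {n : ℕ} .{{_ : NonZero n}} → Seq n → ℤ
total {n} X = sumTo n (at X)

PAF : {v : ℕ} .{{_ : NonZero v}} → Seq v → ℕ → ℤ
PAF {v} A s = sumTo v (λ k → at A k * at A (k ℕ.+ s))

PM1 : {v : ℕ} → Seq v → Set
PM1 A = ∀ i → A i ≡ + 1 ⊎ A i ≡ - + 1

-- periodic Golay pair of length v = 2 * h (so v/2 = h)
PeriodicGolayPair : (h : ℕ) .{{_ : NonZero (2 ℕ.* h)}} → Seq (2 ℕ.* h) → Seq (2 ℕ.* h) → Set
PeriodicGolayPair h A B =
  PM1 A × PM1 B × (∀ s → 1 ℕ.≤ s → s ℕ.≤ h → PAF A s + PAF B s ≡ + 0)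

-- m-compression of a sequence of length v = m * L, giving length L = v/m:
-- entry k is Σ_{j=0}^{m-1} a_{k + j L}
compress : {v : ℕ} .{{_ : NonZero v}} → (m L : ℕ) → Seq v → Seq L
compress m L A k = sumTo m (λ j → at A (toℕ k ℕ.+ j ℕ.* L))

Pair : ℕ → Set
Pair n = Seq n × Seq n

altSign : ℕ → ℤ → ℤ
altSign zero x = x
altSign (suc zero) x = - x
altSign (suc (suc i)) x = altSign i x

data Op {n : ℕ} .{{_ : NonZero n}} : Pair n → Pair n → Set where
  swap : ∀ {X Y X' Y'} →
    (∀ i → X' i ≡ Y i) → (∀ i → Y' i ≡ X i) → Op (X , Y) (X' , Y')
  shift₁ : ∀ {X Y X' Y'} (t : ℕ) →
    (∀ i → X' i ≡ at X (toℕ i ℕ.+ t)) → (∀ i → Y' i ≡ Y i) → Op (X , Y) (X' , Y')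
  shift₂ : ∀ {X Y X' Y'} (t : ℕ) →
    (∀ i → X' i ≡ X i) → (∀ i → Y' i ≡ at Y (toℕ i ℕ.+ t)) → Op (X , Y) (X' , Y')
  reverse₁ : ∀ {X Y X' Y'} →
    (∀ i → X' i ≡ at X (n ℕ.∸ 1 ℕ.∸ toℕ i)) → (∀ i → Y' i ≡ Y i) → Op (X , Y) (X' , Y')
  reverse₂ : ∀ {X Y X' Y'} →
    (∀ i → X' i ≡ X i) → (∀ i → Y' i ≡ at Y (n ℕ.∸ 1 ℕ.∸ toℕ i)) → Op (X , Y) (X' , Y')
  decimate : ∀ {X Y X' Y'} (k : ℕ) → Coprime k n →
    (∀ i → X' i ≡ at X (k ℕ.* toℕ i)) → (∀ i → Y' i ≡ at Y (k ℕ.* toℕ i)) → Op (X , Y) (X' , Y')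
  altNeg : ∀ {X Y X' Y'} →
    (∀ i → X' i ≡ altSign (toℕ i) (X i)) → (∀ i → Y' i ≡ altSign (toℕ i) (Y i)) → Op (X , Y) (X' , Y')

Equivalent : {n : ℕ} .{{_ : NonZero n}} → Pair n → Pair n → Set
Equivalent = EqClosure Op

seq2 : ℤ → ℤ → Seq 2
seq2 x y Fin.zero = x
seq2 x y (Fin.suc Fin.zero) = y

{-# OPTIONS --safe #-}
-- Let e, o and e′, o′ be the sums of the even- and odd-indexed entries of A and B, so that the
-- (v/2)-compressions are [e, o] and [e′, o′]. Weighting PAF_A(s) + PAF_B(s), which vanishes for s ≢ 0
-- and equals 2v at s = 0, by the characters s ↦ 1 and s ↦ (−1)ˢ of ℤ/v gives
--   (e + o)² + (e′ + o′)² = 2v = (e − o)² + (e′ − o′)².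
-- Under the hypothesis on v/2, the number 2v = 4·(v/2) is a sum of two squares in essentially one way:
-- representations of 2m and of m correspond via (x, y) ↦ (x + y, x − y); a prime r ≡ 3 (mod 4) dividing
-- a² + b² divides a and b (Fermat's little theorem), so r² can be divided out; and when n is 1 or a prime,
-- (ad − bc)(ad + bc) = n(a² − c²) together with Brahmagupta's identity forces c² ∈ {a², b²}.
-- So (e − o)² is (e + o)² or (e′ + o′)², and solving for e, o, e′, o′ gives the two compressions up to
-- cyclic shifts.
module Submission where

module Fermat where

  open import Data.Nat.Base
  open import Data.Nat.Properties
  open import Data.Nat.Divisibility
  open import Data.Nat.Primality
  open import Data.Nat.Combinatorics
  open import Data.Nat.DivMod using (m≡m%n+[m/n]*n; m%n≤m)
  open import Data.Nat.Tactic.RingSolver using (solve-∀)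
  open import Data.Fin.Base using (Fin; zero; suc; toℕ; inject₁; fromℕ)
  open import Data.Fin.Properties using (toℕ-inject₁; toℕ<n; toℕ-fromℕ)
  open import Data.Vec.Functional using (Vector; init)
  open import Algebra.Properties.Monoid.Sum +-0-monoid using (sum; sum-init-last)
  import Algebra.Properties.CommutativeSemiring.Binomial +-*-commutativeSemiring as Binomial
  import Algebra.Properties.Semiring.Mult +-*-semiring as Multiple
  import Algebra.Properties.Semiring.Exp +-*-semiring as Power
  open import Data.Product using (∃-syntax; _,_)
  open import Data.Sum using (inj₁; inj₂; [_,_]′)
  open import Function.Base using (_∘_; case_of_)
  open import Relation.Binary.PropositionalEquality
  open import Relation.Nullary using (¬_; yes; no)
  open import Relation.Nullary.Negation using (contradiction)

  suc-*-C : ∀ n k → suc k * (suc n C suc k) ≡ suc n * (n C k)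
  suc-*-C zero    zero    = refl
  suc-*-C zero    (suc k) = *-zeroʳ (suc k)
  suc-*-C (suc n) zero    = begin
    suc (suc n) C 1 + 0    ≡⟨ +-identityʳ _ ⟩
    suc (suc n) C 1        ≡⟨ nC1≡n (suc (suc n)) ⟩
    suc (suc n)            ≡⟨ *-identityʳ (suc (suc n)) ⟨
    suc (suc n) * 1        ∎
    where open ≡-Reasoning
  suc-*-C (suc n) (suc k) = begin
    suc (suc k) * (suc (suc n) C suc (suc k))
      ≡⟨ cong (suc (suc k) *_) (nCk+nC[k+1]≡[n+1]C[k+1] (suc n) (suc k)) ⟨
    suc (suc k) * (X + Y)
      ≡⟨ *-distribˡ-+ (suc (suc k)) X Y ⟩
    X + suc k * X + suc (suc k) * Y
      ≡⟨ cong₂ (λ u w → X + u + w) (suc-*-C n k) (suc-*-C n (suc k)) ⟩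
    X + suc n * (n C k) + suc n * (n C suc k)
      ≡⟨ +-assoc X _ _ ⟩
    X + (suc n * (n C k) + suc n * (n C suc k))
      ≡⟨ cong (X +_) (*-distribˡ-+ (suc n) (n C k) (n C suc k)) ⟨
    X + suc n * (n C k + n C suc k)
      ≡⟨ cong (λ u → X + suc n * u) (nCk+nC[k+1]≡[n+1]C[k+1] n k) ⟩
    suc (suc n) * X
      ∎
    where
    open ≡-Reasoning
    X Y : ℕ
    X = suc n C suc k
    Y = suc n C suc (suc k)

  prime∣pCk : ∀ {p k} → Prime p → 0 < k → k < p → p ∣ p C k
  prime∣pCk {suc n} {suc j} pr _ k<p
    with euclidsLemma (suc j) (suc n C suc j) pr (divides (n C j) (trans (suc-*-C n j) (*-comm (suc n) (n C j))))
  ... | inj₁ p∣k = contradiction p∣k (>⇒∤ k<p)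
  ... | inj₂ p∣C = p∣C

  ∣-sum : ∀ {d n} (f : Vector ℕ n) → (∀ i → d ∣ f i) → d ∣ sum f
  ∣-sum {d} {zero}  f _   = d ∣0
  ∣-sum {d} {suc n} f d∣f = ∣m∣n⇒∣m+n (d∣f zero) (∣-sum (f ∘ suc) (d∣f ∘ suc))

  ×≡* : ∀ m n → m Multiple.× n ≡ m * n
  ×≡* zero    n = refl
  ×≡* (suc m) n = cong (n +_) (×≡* m n)

  ^≡^ : ∀ m n → m Power.^ n ≡ m ^ n
  ^≡^ m zero    = refl
  ^≡^ m (suc n) = cong (m *_) (^≡^ m n)

  binomialTerm[x,1] : ∀ x n (k : Fin (suc n)) → Binomial.binomialTerm x 1 n k ≡ (n C toℕ k) * x ^ toℕ k
  binomialTerm[x,1] x n k = begin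
    (n C toℕ k) Multiple.× (x Power.^ toℕ k * 1 Power.^ (n ∸ toℕ k))
      ≡⟨ ×≡* (n C toℕ k) _ ⟩
    (n C toℕ k) * (x Power.^ toℕ k * 1 Power.^ (n ∸ toℕ k))
      ≡⟨ cong (λ u → (n C toℕ k) * (x Power.^ toℕ k * u)) (trans (^≡^ 1 (n ∸ toℕ k)) (^-zeroˡ (n ∸ toℕ k))) ⟩
    (n C toℕ k) * (x Power.^ toℕ k * 1)
      ≡⟨ cong ((n C toℕ k) *_) (trans (*-identityʳ _) (^≡^ x (toℕ k))) ⟩
    (n C toℕ k) * x ^ toℕ k
      ∎
    where open ≡-Reasoning

  freshmansDream : ∀ {p} → Prime p → ∀ x → ∃[ q ] (x + 1) ^ p ≡ 1 + x ^ p + q * p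
  freshmansDream {p@(suc (suc r))} pr x = quotient p∣init , (begin
    (x + 1) ^ p                                ≡⟨ ^≡^ (x + 1) p ⟨
    (x + 1) Power.^ p                          ≡⟨ Binomial.theorem p x 1 ⟩
    t zero + sum (t ∘ suc)                     ≡⟨ cong (t zero +_) (sum-init-last (t ∘ suc)) ⟩
    t zero + (sum (init (t ∘ suc)) + t (suc (fromℕ (suc r))))
      ≡⟨ cong₂ (λ u w → u + (w + t (suc (fromℕ (suc r))))) t-first (m∣n⇒n≡quotient*m p∣init) ⟩
    1 + (quotient p∣init * p + t (suc (fromℕ (suc r))))
      ≡⟨ cong (λ u → 1 + (quotient p∣init * p + u)) t-last ⟩
    1 + (quotient p∣init * p + x ^ p)         ≡⟨ cong suc (+-comm (quotient p∣init * p) (x ^ p)) ⟩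
    1 + x ^ p + quotient p∣init * p           ∎)
    where
    open ≡-Reasoning
    t : Fin (suc p) → ℕ
    t = Binomial.binomialTerm x 1 p
    p∣init : p ∣ sum (init (t ∘ suc))
    p∣init = ∣-sum (init (t ∘ suc)) λ i → subst (p ∣_) (sym (binomialTerm[x,1] x p (suc (inject₁ i))))
      (∣m⇒∣m*n _ (prime∣pCk pr (s≤s z≤n) (s≤s (subst (_< suc r) (sym (toℕ-inject₁ i)) (toℕ<n i)))))
    t-first : t zero ≡ 1
    t-first = binomialTerm[x,1] x p zero
    t-last : t (suc (fromℕ (suc r))) ≡ x ^ p
    t-last = begin
      t (suc (fromℕ (suc r)))  ≡⟨ binomialTerm[x,1] x p (suc (fromℕ (suc r))) ⟩
      (p C toℕ (suc (fromℕ (suc r)))) * x ^ toℕ (suc (fromℕ (suc r)))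
                               ≡⟨ cong (λ k → (p C k) * x ^ k) (cong suc (toℕ-fromℕ (suc r))) ⟩
      (p C p) * x ^ p          ≡⟨ cong (_* x ^ p) (nCn≡1 p) ⟩
      1 * x ^ p                ≡⟨ *-identityˡ (x ^ p) ⟩
      x ^ p                    ∎

  fermatsLittleTheorem : ∀ {p} → Prime p → ∀ x → ∃[ q ] x ^ p ≡ x + q * p
  fermatsLittleTheorem {suc _} pr zero = 0 , refl
  fermatsLittleTheorem {p} pr (suc x) with fermatsLittleTheorem pr x | freshmansDream pr x
  ... | q , x^p≡ | Q , [x+1]^p≡ = q + Q , (begin
    suc x ^ p               ≡⟨ cong (_^ p) (+-comm 1 x) ⟩
    (x + 1) ^ p             ≡⟨ [x+1]^p≡ ⟩
    1 + x ^ p + Q * p       ≡⟨ cong (λ u → 1 + u + Q * p) x^p≡ ⟩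
    1 + (x + q * p) + Q * p ≡⟨ regroup x q Q p ⟩
    suc x + (q + Q) * p     ∎)
    where
    open ≡-Reasoning
    regroup : ∀ x q Q p → 1 + (x + q * p) + Q * p ≡ 1 + x + (q + Q) * p
    regroup = solve-∀

  fermatsLittleTheorem-∤ : ∀ {p x} → Prime p → ¬ p ∣ x → ∃[ q ] x ^ (p ∸ 1) ≡ q * p + 1
  fermatsLittleTheorem-∤ {p@(suc n)} {x} pr p∤x with fermatsLittleTheorem pr x
  ... | q , x^p≡ = case euclidsLemma x (x ^ n ∸ 1) pr (divides q x*[x^n∸1]≡q*p) of λ where
      (inj₁ p∣x)                   → contradiction p∣x p∤x
      (inj₂ (divides u x^n∸1≡u*p)) → u , (begin
        x ^ n          ≡⟨ m∸n+n≡m 1≤x^n ⟨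
        x ^ n ∸ 1 + 1  ≡⟨ cong (_+ 1) x^n∸1≡u*p ⟩
        u * p + 1      ∎)
    where
    open ≡-Reasoning
    x*[x^n∸1]≡q*p : x * (x ^ n ∸ 1) ≡ q * p
    x*[x^n∸1]≡q*p = begin
      x * (x ^ n ∸ 1)   ≡⟨ *-distribˡ-∸ x (x ^ n) 1 ⟩
      x ^ p ∸ x * 1     ≡⟨ cong₂ _∸_ x^p≡ (*-identityʳ x) ⟩
      x + q * p ∸ x     ≡⟨ m+n∸m≡n x (q * p) ⟩
      q * p             ∎
    x≢0 : x ≢ 0
    x≢0 x≡0 = p∤x (subst (p ∣_) (sym x≡0) (p ∣0))
    1≤x^n : 1 ≤ x ^ n
    1≤x^n = m^n>0 x {{≢-nonZero x≢0}} n

  m+n∣m^odd+n^odd : ∀ m n t → m + n ∣ m ^ suc (t * 2) + n ^ suc (t * 2)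
  m+n∣m^odd+n^odd m n zero    = subst (m + n ∣_) (sym (cong₂ _+_ (*-identityʳ m) (*-identityʳ n))) ∣-refl
  m+n∣m^odd+n^odd m n (suc t) = ∣m+n∣m⇒∣n
    (subst (m + n ∣_) (expand m n (m ^ suc (t * 2)) (n ^ suc (t * 2))) (m∣m*n _))
    (∣n⇒∣m*n (m * n) (m+n∣m^odd+n^odd m n t))
    where
    expand : ∀ m n a b → (m + n) * (m * a + n * b) ≡ m * n * (a + b) + (m * (m * a) + n * (n * b))
    expand = solve-∀

  %4≡3⇒x²+y²∣x^[n∸1]+y^[n∸1] : ∀ {n} → n % 4 ≡ 3 → ∀ x y → x * x + y * y ∣ x ^ (n ∸ 1) + y ^ (n ∸ 1)
  %4≡3⇒x²+y²∣x^[n∸1]+y^[n∸1] {n} n%4≡3 x y =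
    subst (x * x + y * y ∣_) (cong₂ _+_ (square^odd x) (square^odd y)) (m+n∣m^odd+n^odd (x * x) (y * y) t)
    where
    t : ℕ
    t = n / 4
    n∸1≡2*[2t+1] : n ∸ 1 ≡ 2 * suc (t * 2)
    n∸1≡2*[2t+1] = trans (cong (_∸ 1) (trans (m≡m%n+[m/n]*n n 4) (cong (_+ t * 4) n%4≡3))) (double t)
      where
      double : ∀ t → 2 + t * 4 ≡ 2 * suc (t * 2)
      double = solve-∀
    square^odd : ∀ z → (z * z) ^ suc (t * 2) ≡ z ^ (n ∸ 1)
    square^odd z = begin
      (z * z) ^ suc (t * 2)      ≡⟨ cong (λ u → (z * u) ^ suc (t * 2)) (*-identityʳ z) ⟨
      (z ^ 2) ^ suc (t * 2)      ≡⟨ ^-*-assoc z 2 (suc (t * 2)) ⟩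
      z ^ (2 * suc (t * 2))      ≡⟨ cong (z ^_) n∸1≡2*[2t+1] ⟨
      z ^ (n ∸ 1)                ∎
      where open ≡-Reasoning

  -- If p ∤ x then also p ∤ y, and p would divide x^(p∸1) + y^(p∸1), which is ≡ 2 (mod p) by Fermat.
  prime≡3[mod4]∣x²+y²⇒∣x : ∀ {p} → Prime p → p % 4 ≡ 3 → ∀ x y → p ∣ x * x + y * y → p ∣ x
  prime≡3[mod4]∣x²+y²⇒∣x {p} pr p%4≡3 x y p∣x²+y² with p ∣? x
  ... | yes p∣x = p∣x
  ... | no  p∤x = contradiction (∣⇒≤ p∣2) (<⇒≱ (subst (_≤ p) p%4≡3 (m%n≤m p 4)))
    where
    p∤y : ¬ p ∣ y
    p∤y p∣y = [ p∤x , p∤x ]′ (euclidsLemma x x pr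
      (∣m+n∣m⇒∣n (subst (p ∣_) (+-comm (x * x) (y * y)) p∣x²+y²) (∣m⇒∣m*n y p∣y)))
    p∣2 : p ∣ 2
    p∣2 with fermatsLittleTheorem-∤ pr p∤x | fermatsLittleTheorem-∤ pr p∤y
    ... | u , x^[p∸1]≡ | w , y^[p∸1]≡ = ∣m+n∣m⇒∣n
      (subst (p ∣_) (trans (cong₂ _+_ x^[p∸1]≡ y^[p∸1]≡) (regroup u w p))
        (∣-trans p∣x²+y² (%4≡3⇒x²+y²∣x^[n∸1]+y^[n∸1] {p} p%4≡3 x y)))
      (n∣m*n (u + w))
      where
      regroup : ∀ u w p → u * p + 1 + (w * p + 1) ≡ (u + w) * p + 2
      regroup = solve-∀

module SplitPart where

  open import Data.Nat.Base
  open import Data.Nat.Properties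
  open import Data.Nat.Divisibility
  open import Data.Nat.DivMod using (m%n<n)
  open import Data.Nat.Coprimality using (Coprime; coprime-divisor)
  open import Data.Nat.Primality
  open import Data.Nat.Primality.Factorisation using (factorise)
  open import Data.Nat.ListAction using (product)
  open import Data.List.Base using ([]; _∷_)
  open import Data.List.Relation.Unary.All using (_∷_)
  open import Data.Product using (∃; ∃-syntax; _×_; _,_; proj₂)
  open import Data.Sum using (_⊎_; inj₁; inj₂; [_,_]′)
  open import Function.Base using (_∘_; flip; case_of_; _∋_)
  open import Relation.Binary.PropositionalEquality
  open import Relation.Nullary using (¬_)
  open import Relation.Nullary.Negation using (contradiction)

  -- The primes ≡ 1 (mod 4) are the rational primes that split in ℤ[i].
  SplitPrime : ℕ → Set
  SplitPrime p = Prime p × p % 4 ≡ 1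

  record SplitPartOneOrPrime (n : ℕ) : Set where
    field
      squarefree : ∀ {p} → SplitPrime p → p ∣ n → ¬ p * p ∣ n
      unique     : ∀ {p q} → SplitPrime p → SplitPrime q → p ∣ n → q ∣ n → p ≡ q

  open SplitPartOneOrPrime

  splitPartOneOrPrime-∣ : ∀ {m n} → m ∣ n → SplitPartOneOrPrime n → SplitPartOneOrPrime m
  splitPartOneOrPrime-∣ m∣n split = record
    { squarefree = λ p-split p∣m p²∣m → squarefree split p-split (∣-trans p∣m m∣n) (∣-trans p²∣m m∣n)
    ; unique     = λ p-split q-split p∣m q∣m → unique split p-split q-split (∣-trans p∣m m∣n) (∣-trans q∣m m∣n)
    }

  %4≡1⇒¬2∣ : ∀ {n} → n % 4 ≡ 1 → ¬ 2 ∣ n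
  %4≡1⇒¬2∣ n%4≡1 2∣n = case ∣1⇒≡1 (subst (2 ∣_) n%4≡1 (%-presˡ-∣ 2∣n (divides 2 refl))) of λ ()

  ¬2∣⇒%4≡1∨%4≡3 : ∀ {n} → ¬ 2 ∣ n → n % 4 ≡ 1 ⊎ n % 4 ≡ 3
  ¬2∣⇒%4≡1∨%4≡3 {n} 2∤n with n % 4 | m%n<n n 4 | ∣n∣m%n⇒∣m {m = n} (2 ∣ 4 ∋ divides 2 refl)
  ... | 0 | _ | 2∣n%4⇒2∣n = contradiction (2∣n%4⇒2∣n (divides 0 refl)) 2∤n
  ... | 1 | _ | _         = inj₁ refl
  ... | 2 | _ | 2∣n%4⇒2∣n = contradiction (2∣n%4⇒2∣n (divides 1 refl)) 2∤n
  ... | 3 | _ | _         = inj₂ refl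
  ... | suc (suc (suc (suc _))) | s≤s (s≤s (s≤s (s≤s ()))) | _

  ¬2∣⇒coprime-2 : ∀ {d} → ¬ 2 ∣ d → Coprime d 2
  ¬2∣⇒coprime-2 2∤d {zero}                (_ , 0∣2)  = case 0∣⇒≡0 0∣2 of λ ()
  ¬2∣⇒coprime-2 2∤d {1}                   _          = refl
  ¬2∣⇒coprime-2 2∤d {2}                   (2∣d , _)  = contradiction 2∣d 2∤d
  ¬2∣⇒coprime-2 2∤d {suc (suc (suc i))}   (_ , i∣2) = contradiction (∣⇒≤ i∣2) λ { (s≤s (s≤s ())) }

  splitPartOneOrPrime-2* : ∀ {n} → SplitPartOneOrPrime n → SplitPartOneOrPrime (2 * n)
  splitPartOneOrPrime-2* {n} split = record
    { squarefree = λ {p} p-split p∣2n p²∣2n →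
        squarefree split p-split (halve (p-odd p-split) p∣2n) (halve (p²-odd p-split) p²∣2n)
    ; unique     = λ p-split q-split p∣2n q∣2n →
        unique split p-split q-split (halve (p-odd p-split) p∣2n) (halve (p-odd q-split) q∣2n)
    }
    where
    halve : ∀ {d} → ¬ 2 ∣ d → d ∣ 2 * n → d ∣ n
    halve = coprime-divisor ∘ ¬2∣⇒coprime-2
    p-odd : ∀ {p} → SplitPrime p → ¬ 2 ∣ p
    p-odd = %4≡1⇒¬2∣ ∘ proj₂
    p²-odd : ∀ {p} → SplitPrime p → ¬ 2 ∣ p * p
    p²-odd {p} p-split = [ p-odd p-split , p-odd p-split ]′ ∘ euclidsLemma p p prime[2]

  primeFactor : ∀ {n} → 2 ≤ n → ∃[ p ] Prime p × p ∣ n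
  primeFactor {n@(suc _)} 2≤n with factorise n
  ... | record { factors = [] ; isFactorisation = n≡1 } = contradiction 2≤n (<-irrefl (sym n≡1))
  ... | record { factors = p ∷ ps ; isFactorisation = n≡p*ps ; factorsPrime = p-prime ∷ _ } =
    p , p-prime , divides (product ps) (trans n≡p*ps (*-comm p (product ps)))

  splitPrime-cofactor : ∀ {n p q} → SplitPartOneOrPrime n → ¬ 2 ∣ n → SplitPrime p →
    n ≡ q * p → 2 ≤ q → ∃[ r ] Prime r × r % 4 ≡ 3 × r ∣ n
  splitPrime-cofactor {n} {p} {q} split 2∤n p-split n≡q*p 2≤q =
    let s , s-prime , s∣q = primeFactor 2≤q
        s∣n = ∣-trans s∣q q∣n
    in case ¬2∣⇒%4≡1∨%4≡3 (2∤n ∘ flip ∣-trans s∣n) of λ where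
      (inj₂ s%4≡3) → s , s-prime , s%4≡3 , s∣n
      (inj₁ s%4≡1) → contradiction
        (subst (_∣ n) (cong (_* p) (unique split (s-prime , s%4≡1) p-split s∣n p∣n))
          (subst (s * p ∣_) (sym n≡q*p) (*-monoˡ-∣ p s∣q)))
        (squarefree split p-split p∣n)
    where
    p∣n : p ∣ n
    p∣n = divides q n≡q*p
    q∣n : q ∣ n
    q∣n = divides p (trans n≡q*p (*-comm q p))

  splitPartOneOrPrime-odd : ∀ {n} → SplitPartOneOrPrime n → ¬ 2 ∣ n → 2 ≤ n →
    (∃[ r ] Prime r × r % 4 ≡ 3 × r ∣ n) ⊎ Prime n
  splitPartOneOrPrime-odd {n} split 2∤n 2≤n with primeFactor 2≤n
  ... | p , p-prime , p∣n with ¬2∣⇒%4≡1∨%4≡3 (2∤n ∘ flip ∣-trans p∣n)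
  ...   | inj₂ p%4≡3 = inj₁ (p , p-prime , p%4≡3 , p∣n)
  ...   | inj₁ p%4≡1 with p∣n
  ...     | divides zero n≡0            = contradiction (sym n≡0) (<⇒≢ (<-trans z<s 2≤n))
  ...     | divides 1 n≡p               = inj₂ (subst Prime (sym (trans n≡p (+-identityʳ p))) p-prime)
  ...     | divides (suc (suc q)) n≡q*p =
    inj₁ (splitPrime-cofactor {q = suc (suc q)} split 2∤n (p-prime , p%4≡1) n≡q*p (s≤s (s≤s z≤n)))

  splitPartOneOrPrime-fromHypothesis : ∀ {h} →
    (∀ p → Prime p → p % 4 ≡ 1 → ¬ (p ∣ h))
    ⊎ ∃ (λ p → Prime p × p % 4 ≡ 1 × p ∣ h × ¬ (p ^ 2 ∣ h) × (∀ q → Prime q → q % 4 ≡ 1 → q ∣ h → q ≡ p)) →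
    SplitPartOneOrPrime h
  splitPartOneOrPrime-fromHypothesis (inj₁ none) = record
    { squarefree = λ { (p-prime , p%4≡1) p∣h _ → none _ p-prime p%4≡1 p∣h }
    ; unique     = λ { (p-prime , p%4≡1) _ p∣h _ → contradiction p∣h (none _ p-prime p%4≡1) }
    }
  splitPartOneOrPrime-fromHypothesis {h} (inj₂ (p₀ , _ , _ , _ , p₀²∤h , onlyP₀)) = record
    { squarefree = λ p-split p∣h p²∣h → p₀²∤h (subst (_∣ h) (square≡p₀^2 (≡p₀ p-split p∣h)) p²∣h)
    ; unique     = λ p-split q-split p∣h q∣h → trans (≡p₀ p-split p∣h) (sym (≡p₀ q-split q∣h))
    }
    where
    ≡p₀ : ∀ {p} → SplitPrime p → p ∣ h → p ≡ p₀
    ≡p₀ (p-prime , p%4≡1) = onlyP₀ _ p-prime p%4≡1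
    square≡p₀^2 : ∀ {p} → p ≡ p₀ → p * p ≡ p₀ ^ 2
    square≡p₀^2 refl = cong (p₀ *_) (sym (*-identityʳ p₀))

module SumsOfTwoSquares where

  open import Data.Nat.Base as ℕ using (ℕ; zero; suc; z≤n; s≤s; _%_)
  import Data.Nat.Properties as ℕ
  open import Data.Nat.Divisibility as ℕ using (divides; _∣?_)
  open import Data.Nat.Primality
  open import Data.Integer.Base hiding (_%_)
  open import Data.Integer.Properties
  import Data.Integer.Divisibility.Signed as ℤ
  open import Data.Integer.Tactic.RingSolver using (solve-∀)
  open import Algebra.Bundles using (AbelianGroup)
  open import Algebra.Properties.Group (AbelianGroup.group +-0-abelianGroup) using (∙-cancelˡ; ∙-cancelʳ; inverseʳ-unique)
  open import Data.Product using (∃-syntax; _×_; _,_)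
  open import Data.Sum as Sum using (_⊎_; inj₁; inj₂; [_,_]′)
  open import Function.Base using (_∘_; id)
  open import Relation.Binary.PropositionalEquality
  open import Relation.Nullary using (yes; no)
  open import Data.Nat.Induction using (<-rec)
  open Fermat
  open SplitPart

  TwoSquaresUnique : ℕ → Set
  TwoSquaresUnique n = ∀ a b c d → a * a + b * b ≡ + n → c * c + d * d ≡ + n → c * c ≡ a * a ⊎ c * c ≡ b * b

  i*i≡∣i∣*∣i∣ : ∀ i → i * i ≡ + (∣ i ∣ ℕ.* ∣ i ∣)
  i*i≡∣i∣*∣i∣ (+ n)    = sym (pos-* n n)
  i*i≡∣i∣*∣i∣ -[1+ n ] = refl

  i*i+j*j≡∣i∣²+∣j∣² : ∀ i j → i * i + j * j ≡ + (∣ i ∣ ℕ.* ∣ i ∣ ℕ.+ ∣ j ∣ ℕ.* ∣ j ∣)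
  i*i+j*j≡∣i∣²+∣j∣² i j = trans (cong₂ _+_ (i*i≡∣i∣*∣i∣ i) (i*i≡∣i∣*∣i∣ j)) (sym (pos-+ (∣ i ∣ ℕ.* ∣ i ∣) (∣ j ∣ ℕ.* ∣ j ∣)))

  i*i≡j*j⇒i≡±j : ∀ i j → i * i ≡ j * j → i ≡ j ⊎ i ≡ - j
  i*i≡j*j⇒i≡±j i j i²≡j² = Sum.map (i-j≡0⇒i≡j i j) (λ i+j≡0 → inverseʳ-unique j i (trans (+-comm j i) i+j≡0))
    (i*j≡0⇒i≡0∨j≡0 (i - j) (trans (factor i j) (i≡j⇒i-j≡0 i²≡j²)))
    where
    factor : ∀ i j → (i - j) * (i + j) ≡ i * i - j * j
    factor = solve-∀

  x²+y²≡n²∧n∣x⇒x≡0∨y≡0 : ∀ n x y → x ℕ.* x ℕ.+ y ℕ.* y ≡ n ℕ.* n → n ℕ.∣ x → x ≡ 0 ⊎ y ≡ 0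
  x²+y²≡n²∧n∣x⇒x≡0∨y≡0 n x y _      (divides zero    x≡0)       = inj₁ x≡0
  x²+y²≡n²∧n∣x⇒x≡0∨y≡0 n x y x²+y²≡n² (divides (suc t) x≡[1+t]*n) =
    inj₂ ([ id , id ]′ (ℕ.m*n≡0⇒m≡0∨n≡0 y (ℕ.n≤0⇒n≡0 y²≤0)))
    where
    n≤x : n ℕ.≤ x
    n≤x = subst (n ℕ.≤_) (sym x≡[1+t]*n) (ℕ.m≤m+n n (t ℕ.* n))
    y²≤0 : y ℕ.* y ℕ.≤ 0
    y²≤0 = ℕ.+-cancelˡ-≤ (x ℕ.* x) (y ℕ.* y) 0 (begin
      x ℕ.* x ℕ.+ y ℕ.* y  ≡⟨ x²+y²≡n² ⟩
      n ℕ.* n              ≤⟨ ℕ.*-mono-≤ n≤x n≤x ⟩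
      x ℕ.* x              ≡⟨ ℕ.+-identityʳ (x ℕ.* x) ⟨
      x ℕ.* x ℕ.+ 0        ∎)
      where open ℕ.≤-Reasoning

  i²+j²≡n²∧n∣i⇒i≡0∨j≡0 : ∀ {n} i j → i * i + j * j ≡ + (n ℕ.* n) → n ℕ.∣ ∣ i ∣ → i ≡ 0ℤ ⊎ j ≡ 0ℤ
  i²+j²≡n²∧n∣i⇒i≡0∨j≡0 {n} i j i²+j²≡n² n∣i = Sum.map ∣i∣≡0⇒i≡0 ∣i∣≡0⇒i≡0
    (x²+y²≡n²∧n∣x⇒x≡0∨y≡0 n ∣ i ∣ ∣ j ∣ (+-injective (trans (sym (i*i+j*j≡∣i∣²+∣j∣² i j)) i²+j²≡n²)) n∣i)

  module _ {n : ℕ} (a b c d : ℤ) (a²+b²≡n : a * a + b * b ≡ + n) (c²+d²≡n : c * c + d * d ≡ + n) where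

    [ad-bc]*[ad+bc]≡[a²-c²]*n : (a * d - b * c) * (a * d + b * c) ≡ (a * a - c * c) * + n
    [ad-bc]*[ad+bc]≡[a²-c²]*n = begin
      (a * d - b * c) * (a * d + b * c)                 ≡⟨ expand a b c d ⟩
      a * a * (c * c + d * d) - c * c * (a * a + b * b) ≡⟨ cong₂ (λ u w → a * a * u - c * c * w) c²+d²≡n a²+b²≡n ⟩
      a * a * + n - c * c * + n                         ≡⟨ factor (a * a) (c * c) (+ n) ⟩
      (a * a - c * c) * + n                             ∎
      where
      open ≡-Reasoning
      expand : ∀ a b c d → (a * d - b * c) * (a * d + b * c) ≡ a * a * (c * c + d * d) - c * c * (a * a + b * b)
      expand = solve-∀
      factor : ∀ x y n → x * n - y * n ≡ (x - y) * n
      factor = solve-∀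

    n*n≡[a²+b²]*[c²+d²] : + (n ℕ.* n) ≡ (a * a + b * b) * (c * c + d * d)
    n*n≡[a²+b²]*[c²+d²] = trans (pos-* n n) (sym (cong₂ _*_ a²+b²≡n c²+d²≡n))

    [ad-bc]²+[ac+bd]²≡n² : (a * d - b * c) * (a * d - b * c) + (a * c + b * d) * (a * c + b * d) ≡ + (n ℕ.* n)
    [ad-bc]²+[ac+bd]²≡n² = trans (brahmagupta a b c d) (sym n*n≡[a²+b²]*[c²+d²])
      where
      brahmagupta : ∀ a b c d → (a * d - b * c) * (a * d - b * c) + (a * c + b * d) * (a * c + b * d)
                              ≡ (a * a + b * b) * (c * c + d * d)
      brahmagupta = solve-∀

    [ad+bc]²+[ac-bd]²≡n² : (a * d + b * c) * (a * d + b * c) + (a * c - b * d) * (a * c - b * d) ≡ + (n ℕ.* n)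
    [ad+bc]²+[ac-bd]²≡n² = trans (brahmagupta a b c d) (sym n*n≡[a²+b²]*[c²+d²])
      where
      brahmagupta : ∀ a b c d → (a * d + b * c) * (a * d + b * c) + (a * c - b * d) * (a * c - b * d)
                              ≡ (a * a + b * b) * (c * c + d * d)
      brahmagupta = solve-∀

  -- Both (ad - bc)² + (ac + bd)² and (ad + bc)² + (ac - bd)² equal n², so if n divides ad ∓ bc then
  -- ad ∓ bc or ac ± bd vanishes; the former gives a² = c², the latter a² = d².
  n∣ad∓bc⇒c²≡a²∨c²≡b² : ∀ {n} .{{_ : ℕ.NonZero n}} a b c d → a * a + b * b ≡ + n → c * c + d * d ≡ + n →
    n ℕ.∣ ∣ a * d - b * c ∣ ⊎ n ℕ.∣ ∣ a * d + b * c ∣ → c * c ≡ a * a ⊎ c * c ≡ b * b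
  n∣ad∓bc⇒c²≡a²∨c²≡b² {n} a b c d a²+b²≡n c²+d²≡n = λ where
      (inj₁ n∣ad-bc) → Sum.map (c²≡a² ∘ inj₁) (c²≡b² ∘ inj₂)
        (i²+j²≡n²∧n∣i⇒i≡0∨j≡0 (a * d - b * c) (a * c + b * d) ([ad-bc]²+[ac+bd]²≡n² a b c d a²+b²≡n c²+d²≡n) n∣ad-bc)
      (inj₂ n∣ad+bc) → Sum.map (c²≡a² ∘ inj₂) (c²≡b² ∘ inj₁)
        (i²+j²≡n²∧n∣i⇒i≡0∨j≡0 (a * d + b * c) (a * c - b * d) ([ad+bc]²+[ac-bd]²≡n² a b c d a²+b²≡n c²+d²≡n) n∣ad+bc)
    where
    open ≡-Reasoning
    a²≡e² : ∀ e f → e * e + f * f ≡ + n → a * f - b * e ≡ 0ℤ ⊎ a * f + b * e ≡ 0ℤ → a * a ≡ e * e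
    a²≡e² e f e²+f²≡n factor≡0 = i-j≡0⇒i≡j (a * a) (e * e) (*-cancelʳ-≡ (a * a - e * e) 0ℤ (+ n)
      (trans (sym ([ad-bc]*[ad+bc]≡[a²-c²]*n a b e f a²+b²≡n e²+f²≡n)) (product≡0 factor≡0)))
      where
      product≡0 : ∀ {x y} → x ≡ 0ℤ ⊎ y ≡ 0ℤ → x * y ≡ 0ℤ
      product≡0     (inj₁ refl) = refl
      product≡0 {x} (inj₂ refl) = *-zeroʳ x
    c²≡a² : a * d - b * c ≡ 0ℤ ⊎ a * d + b * c ≡ 0ℤ → c * c ≡ a * a
    c²≡a² = sym ∘ a²≡e² c d c²+d²≡n
    c²≡b² : a * c - b * d ≡ 0ℤ ⊎ a * c + b * d ≡ 0ℤ → c * c ≡ b * b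
    c²≡b² factor≡0 = ∙-cancelʳ (d * d) (c * c) (b * b) (begin
      c * c + d * d  ≡⟨ trans c²+d²≡n (sym a²+b²≡n) ⟩
      a * a + b * b  ≡⟨ +-comm (a * a) (b * b) ⟩
      b * b + a * a  ≡⟨ cong (λ u → b * b + u) (a²≡e² d c (trans (+-comm (d * d) (c * c)) c²+d²≡n) factor≡0) ⟩
      b * b + d * d  ∎)

  twoSquaresUnique-1 : TwoSquaresUnique 1
  twoSquaresUnique-1 a b c d a²+b²≡1 c²+d²≡1 = n∣ad∓bc⇒c²≡a²∨c²≡b² a b c d a²+b²≡1 c²+d²≡1 (inj₁ (ℕ.1∣ _))

  twoSquaresUnique-prime : ∀ {p} → Prime p → TwoSquaresUnique p
  twoSquaresUnique-prime {p} pr a b c d a²+b²≡p c²+d²≡p =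
    n∣ad∓bc⇒c²≡a²∨c²≡b² {{prime⇒nonZero pr}} a b c d a²+b²≡p c²+d²≡p (euclidsLemma _ _ pr p∣product)
    where
    p∣product : p ℕ.∣ ∣ a * d - b * c ∣ ℕ.* ∣ a * d + b * c ∣
    p∣product = subst (p ℕ.∣_) (abs-* (a * d - b * c) (a * d + b * c))
      (ℤ.∣⇒∣ᵤ (ℤ.divides (a * a - c * c) ([ad-bc]*[ad+bc]≡[a²-c²]*n a b c d a²+b²≡p c²+d²≡p)))

  module _ {m : ℕ} (a b : ℤ) (a²+b²≡2m : a * a + b * b ≡ + (m ℕ.* 2)) where

    2∣a+b : + 2 ℤ.∣ a + b
    2∣a+b = ℤ.∣ᵤ⇒∣ ([ id , id ]′ (euclidsLemma ∣ a + b ∣ ∣ a + b ∣ prime[2]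
      (subst (2 ℕ.∣_) (abs-* (a + b) (a + b)) (ℤ.∣⇒∣ᵤ (ℤ.divides (+ m + a * b) [a+b]²≡[m+ab]*2)))))
      where
      open ≡-Reasoning
      [a+b]²≡[m+ab]*2 : (a + b) * (a + b) ≡ (+ m + a * b) * + 2
      [a+b]²≡[m+ab]*2 = begin
        (a + b) * (a + b)               ≡⟨ expand a b ⟩
        a * a + b * b + a * b * + 2     ≡⟨ cong (λ u → u + a * b * + 2) (trans a²+b²≡2m (pos-* m 2)) ⟩
        + m * + 2 + a * b * + 2         ≡⟨ *-distribʳ-+ (+ 2) (+ m) (a * b) ⟨
        (+ m + a * b) * + 2             ∎
        where
        expand : ∀ a b → (a + b) * (a + b) ≡ a * a + b * b + a * b * + 2
        expand = solve-∀

    halfSumAndDifference : ∃[ x ] ∃[ y ] a ≡ x + y × b ≡ x - y × x * x + y * y ≡ + m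
    halfSumAndDifference with 2∣a+b
    ... | ℤ.divides k a+b≡2k = k , k - b , a≡ , reconstruct-b k b , *-cancelʳ-≡ _ _ (+ 2) (begin
      (k * k + (k - b) * (k - b)) * + 2   ≡⟨ doubled k b ⟩
      (k + (k - b)) * (k + (k - b)) + b * b ≡⟨ cong (λ u → u * u + b * b) a≡ ⟨
      a * a + b * b                       ≡⟨ trans a²+b²≡2m (pos-* m 2) ⟩
      + m * + 2                           ∎)
      where
      open ≡-Reasoning
      reconstruct-a : ∀ a b → a ≡ (a + b) - b
      reconstruct-a = solve-∀
      rearrange : ∀ k b → k * + 2 - b ≡ k + (k - b)
      rearrange = solve-∀
      reconstruct-b : ∀ k b → b ≡ k - (k - b)
      reconstruct-b = solve-∀
      doubled : ∀ k b → (k * k + (k - b) * (k - b)) * + 2 ≡ (k + (k - b)) * (k + (k - b)) + b * b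
      doubled = solve-∀
      a≡ : a ≡ k + (k - b)
      a≡ = trans (reconstruct-a a b) (trans (cong (_- b) a+b≡2k) (rearrange k b))

  squaresMatch-± : ∀ x y z w → z * z ≡ x * x → w * w ≡ y * y →
    (z + w) * (z + w) ≡ (x + y) * (x + y) ⊎ (z + w) * (z + w) ≡ (x - y) * (x - y)
  squaresMatch-± x y z w z²≡x² w²≡y² with i*i≡j*j⇒i≡±j z x z²≡x² | i*i≡j*j⇒i≡±j w y w²≡y²
  ... | inj₁ refl | inj₁ refl = inj₁ refl
  ... | inj₁ refl | inj₂ refl = inj₂ refl
  ... | inj₂ refl | inj₁ refl = inj₂ (flip x y)
    where
    flip : ∀ x y → (- x + y) * (- x + y) ≡ (x - y) * (x - y)
    flip = solve-∀
  ... | inj₂ refl | inj₂ refl = inj₁ (negate x y)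
    where
    negate : ∀ x y → (- x + - y) * (- x + - y) ≡ (x + y) * (x + y)
    negate = solve-∀

  i+j≡k+l∧i≡k⇒j≡l : ∀ {i j k l} → i + j ≡ k + l → i ≡ k → j ≡ l
  i+j≡k+l∧i≡k⇒j≡l {i} {j} {l = l} i+j≡i+l refl = ∙-cancelˡ i j l i+j≡i+l

  squaresMatch-recombine : ∀ x y z w → z * z + w * w ≡ x * x + y * y → z * z ≡ x * x ⊎ z * z ≡ y * y →
    (z + w) * (z + w) ≡ (x + y) * (x + y) ⊎ (z + w) * (z + w) ≡ (x - y) * (x - y)
  squaresMatch-recombine x y z w z²+w²≡x²+y² (inj₁ z²≡x²) =
    squaresMatch-± x y z w z²≡x² (i+j≡k+l∧i≡k⇒j≡l z²+w²≡x²+y² z²≡x²)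
  squaresMatch-recombine x y z w z²+w²≡x²+y² (inj₂ z²≡y²) =
    Sum.map (λ e → trans e (sym-sum x y)) (λ e → trans e (sym-difference x y))
      (squaresMatch-± y x z w z²≡y² (i+j≡k+l∧i≡k⇒j≡l (trans z²+w²≡x²+y² (+-comm (x * x) (y * y))) z²≡y²))
    where
    sym-sum : ∀ x y → (y + x) * (y + x) ≡ (x + y) * (x + y)
    sym-sum = solve-∀
    sym-difference : ∀ x y → (y - x) * (y - x) ≡ (x - y) * (x - y)
    sym-difference = solve-∀

  twoSquaresUnique-double : ∀ {m} → TwoSquaresUnique m → TwoSquaresUnique (m ℕ.* 2)
  twoSquaresUnique-double {m} unique a b c d a²+b²≡2m c²+d²≡2m =
    recombine (halfSumAndDifference {m} a b a²+b²≡2m) (halfSumAndDifference {m} c d c²+d²≡2m)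
    where
    square : ∀ {i j} → i ≡ j → i * i ≡ j * j
    square = cong (λ u → u * u)
    recombine : ∃[ x ] ∃[ y ] a ≡ x + y × b ≡ x - y × x * x + y * y ≡ + m →
                ∃[ z ] ∃[ w ] c ≡ z + w × d ≡ z - w × z * z + w * w ≡ + m →
                c * c ≡ a * a ⊎ c * c ≡ b * b
    recombine (x , y , a≡x+y , b≡x-y , x²+y²≡m) (z , w , c≡z+w , _ , z²+w²≡m) =
      Sum.map (λ e → trans (square c≡z+w) (trans e (sym (square a≡x+y))))
              (λ e → trans (square c≡z+w) (trans e (sym (square b≡x-y))))
        (squaresMatch-recombine x y z w (trans z²+w²≡m (sym x²+y²≡m)) (unique x y z w x²+y²≡m z²+w²≡m))

  prime≡3[mod4]∣i²+j²⇒∣i×∣j : ∀ {r n} → Prime r → r % 4 ≡ 3 → r ℕ.∣ n →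
    ∀ i j → i * i + j * j ≡ + n → + r ℤ.∣ i × + r ℤ.∣ j
  prime≡3[mod4]∣i²+j²⇒∣i×∣j {r} pr r%4≡3 r∣n i j i²+j²≡n =
    ℤ.∣ᵤ⇒∣ {+ r} {i} (prime≡3[mod4]∣x²+y²⇒∣x pr r%4≡3 ∣ i ∣ ∣ j ∣ r∣∣i∣²+∣j∣²) ,
    ℤ.∣ᵤ⇒∣ {+ r} {j} (prime≡3[mod4]∣x²+y²⇒∣x pr r%4≡3 ∣ j ∣ ∣ i ∣
      (subst (r ℕ.∣_) (ℕ.+-comm (∣ i ∣ ℕ.* ∣ i ∣) (∣ j ∣ ℕ.* ∣ j ∣)) r∣∣i∣²+∣j∣²))
    where
    r∣∣i∣²+∣j∣² : r ℕ.∣ ∣ i ∣ ℕ.* ∣ i ∣ ℕ.+ ∣ j ∣ ℕ.* ∣ j ∣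
    r∣∣i∣²+∣j∣² = subst (r ℕ.∣_) (sym (+-injective (trans (sym (i*i+j*j≡∣i∣²+∣j∣² i j)) i²+j²≡n))) r∣n

  square-of-multiple : ∀ {i} j k → i ≡ j * k → i * i ≡ j * j * (k * k)
  square-of-multiple j k refl = rearrange j k
    where
    rearrange : ∀ j k → j * k * (j * k) ≡ j * j * (k * k)
    rearrange = solve-∀

  twoSquaresUnique-descent : ∀ {r n} → Prime r → r % 4 ≡ 3 → r ℕ.∣ n →
    (∀ m → n ≡ m ℕ.* (r ℕ.* r) → TwoSquaresUnique m) → TwoSquaresUnique n
  twoSquaresUnique-descent {r} {n} pr r%4≡3 r∣n unique a b c d a²+b²≡n c²+d²≡n =
    descend (prime≡3[mod4]∣i²+j²⇒∣i×∣j pr r%4≡3 r∣n a b a²+b²≡n) (prime≡3[mod4]∣i²+j²⇒∣i×∣j pr r%4≡3 r∣n c d c²+d²≡n)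
    where
    open ≡-Reasoning
    instance
      r²≢0 : ℕ.NonZero (r ℕ.* r)
      r²≢0 = ℕ.m*n≢0 r r {{prime⇒nonZero pr}} {{prime⇒nonZero pr}}
    r² : ℤ
    r² = + (r ℕ.* r)
    square-of-multiple-r : ∀ {i} j → i ≡ j * + r → i * i ≡ j * j * r²
    square-of-multiple-r j i≡jr = trans (square-of-multiple j (+ r) i≡jr) (cong (j * j *_) (sym (pos-* r r)))
    sum-of-multiples : ∀ {i j} i′ j′ → i ≡ i′ * + r → j ≡ j′ * + r → i * i + j * j ≡ (i′ * i′ + j′ * j′) * r²
    sum-of-multiples i′ j′ i≡ j≡ = trans (cong₂ _+_ (square-of-multiple-r i′ i≡) (square-of-multiple-r j′ j≡))
      (sym (*-distribʳ-+ r² (i′ * i′) (j′ * j′)))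
    descend : + r ℤ.∣ a × + r ℤ.∣ b → + r ℤ.∣ c × + r ℤ.∣ d → c * c ≡ a * a ⊎ c * c ≡ b * b
    descend (ℤ.divides a′ a≡a′r , ℤ.divides b′ b≡b′r) (ℤ.divides c′ c≡c′r , ℤ.divides d′ d≡d′r) =
      Sum.map (rescale c′ a′ c≡c′r a≡a′r) (rescale c′ b′ c≡c′r b≡b′r) (unique m n≡m*r² a′ b′ c′ d′ a′²+b′²≡m c′²+d′²≡m)
      where
      rescale : ∀ {i j} i′ j′ → i ≡ i′ * + r → j ≡ j′ * + r → i′ * i′ ≡ j′ * j′ → i * i ≡ j * j
      rescale i′ j′ i≡ j≡ i′²≡j′² =
        trans (square-of-multiple-r i′ i≡) (trans (cong (_* r²) i′²≡j′²) (sym (square-of-multiple-r j′ j≡)))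
      m : ℕ
      m = ∣ a′ ∣ ℕ.* ∣ a′ ∣ ℕ.+ ∣ b′ ∣ ℕ.* ∣ b′ ∣
      a′²+b′²≡m : a′ * a′ + b′ * b′ ≡ + m
      a′²+b′²≡m = i*i+j*j≡∣i∣²+∣j∣² a′ b′
      n≡m*r² : n ≡ m ℕ.* (r ℕ.* r)
      n≡m*r² = +-injective (begin
        + n                        ≡⟨ a²+b²≡n ⟨
        a * a + b * b              ≡⟨ sum-of-multiples a′ b′ a≡a′r b≡b′r ⟩
        (a′ * a′ + b′ * b′) * r²   ≡⟨ cong (_* r²) a′²+b′²≡m ⟩
        + m * r²                   ≡⟨ pos-* m (r ℕ.* r) ⟨
        + (m ℕ.* (r ℕ.* r))        ∎)
      c′²+d′²≡m : c′ * c′ + d′ * d′ ≡ + m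
      c′²+d′²≡m = trans (*-cancelʳ-≡ _ _ r² (begin
        (c′ * c′ + d′ * d′) * r²   ≡⟨ sum-of-multiples c′ d′ c≡c′r d≡d′r ⟨
        c * c + d * d              ≡⟨ trans c²+d²≡n (sym a²+b²≡n) ⟩
        a * a + b * b              ≡⟨ sum-of-multiples a′ b′ a≡a′r b≡b′r ⟩
        (a′ * a′ + b′ * b′) * r²   ∎)) a′²+b′²≡m

  twoSquaresUnique-0 : TwoSquaresUnique 0
  twoSquaresUnique-0 a b c d a²+b²≡0 c²+d²≡0 = inj₁ (trans (i*i≡0 c d c²+d²≡0) (sym (i*i≡0 a b a²+b²≡0)))
    where
    i*i≡0 : ∀ i j → i * i + j * j ≡ 0ℤ → i * i ≡ 0ℤ
    i*i≡0 i j i²+j²≡0 = trans (i*i≡∣i∣*∣i∣ i)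
      (cong +_ (ℕ.m+n≡0⇒m≡0 _ (+-injective (trans (sym (i*i+j*j≡∣i∣²+∣j∣² i j)) i²+j²≡0))))

  twoSquaresUnique-fromCofactors : ∀ n .{{_ : ℕ.NonZero n}} → SplitPartOneOrPrime n →
    (∀ {m k} → 1 ℕ.< k → n ≡ m ℕ.* k → TwoSquaresUnique m) → TwoSquaresUnique n
  twoSquaresUnique-fromCofactors 1 _ _ = twoSquaresUnique-1
  twoSquaresUnique-fromCofactors n@(suc (suc _)) split cofactor with 2 ∣? n
  ... | yes (divides m n≡m*2) = subst TwoSquaresUnique (sym n≡m*2) (twoSquaresUnique-double {m} (cofactor ℕ.≤-refl n≡m*2))
  ... | no 2∤n with splitPartOneOrPrime-odd split 2∤n (s≤s (s≤s z≤n))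
  ...   | inj₂ n-prime                       = twoSquaresUnique-prime n-prime
  ...   | inj₁ (r , r-prime , r%4≡3 , r∣n) =
    twoSquaresUnique-descent r-prime r%4≡3 r∣n (λ m → cofactor (ℕ.*-mono-< 1<r 1<r))
    where
    1<r : 1 ℕ.< r
    1<r = ℕ.nonTrivial⇒n>1 r {{prime⇒nonTrivial r-prime}}

  n≡m*k⇒m<n : ∀ {n m k} .{{_ : ℕ.NonZero n}} → 1 ℕ.< k → n ≡ m ℕ.* k → m ℕ.< n
  n≡m*k⇒m<n {n} {zero}          _   _     = ℕ.>-nonZero⁻¹ n
  n≡m*k⇒m<n {n} {m@(suc _)} {k} 1<k n≡m*k = subst (m ℕ.<_) (sym n≡m*k) (ℕ.m<m*n m k 1<k)

  splitPartOneOrPrime⇒twoSquaresUnique : ∀ n → SplitPartOneOrPrime n → TwoSquaresUnique n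
  splitPartOneOrPrime⇒twoSquaresUnique = <-rec _ λ where
    zero      _      _     → twoSquaresUnique-0
    n@(suc _) smaller split → twoSquaresUnique-fromCofactors n split λ {m} {k} 1<k n≡m*k →
      smaller (n≡m*k⇒m<n 1<k n≡m*k) (splitPartOneOrPrime-∣ (divides k (trans n≡m*k (ℕ.*-comm m k))) split)

module Autocorrelation where

  open import Defs
  open import Data.Nat.Base as ℕ using (ℕ; zero; suc; z≤n; s≤s; NonZero)
  import Data.Nat.Properties as ℕ
  open import Data.Nat.DivMod using (m%n<n; [m+n]%n≡m%n)
  open import Data.Fin.Patterns using (0F; 1F)
  open import Data.Fin.Properties using (fromℕ<-cong)
  open import Data.Integer.Base using (ℤ; +_; -_; _+_; _-_; _*_; 0ℤ)
  open import Data.Integer.Properties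
  open import Data.Integer.Tactic.RingSolver using (solve-∀)
  open import Function.Base using (_∘_)
  open import Data.Sum.Base using (_⊎_; inj₁; inj₂)
  open import Algebra.Bundles using (AbelianGroup)
  open import Algebra.Properties.Group (AbelianGroup.group +-0-abelianGroup) using (∙-cancelʳ)
  open import Relation.Binary.PropositionalEquality
  open import Relation.Nullary using (yes; no)
  open import Data.Product.Base using (proj₁; proj₂)

  sumTo-cong : ∀ n {f g : ℕ → ℤ} → (∀ i → f i ≡ g i) → sumTo n f ≡ sumTo n g
  sumTo-cong zero    f≡g = refl
  sumTo-cong (suc n) f≡g = cong₂ _+_ (sumTo-cong n f≡g) (f≡g n)

  sumTo-+ : ∀ n (f g : ℕ → ℤ) → sumTo n (λ i → f i + g i) ≡ sumTo n f + sumTo n g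
  sumTo-+ zero    f g = refl
  sumTo-+ (suc n) f g = trans (cong (_+ (f n + g n)) (sumTo-+ n f g)) (interchange (sumTo n f) (sumTo n g) (f n) (g n))
    where
    interchange : ∀ a b c d → a + b + (c + d) ≡ a + c + (b + d)
    interchange = solve-∀

  sumTo-*ˡ : ∀ n c (f : ℕ → ℤ) → sumTo n (λ i → c * f i) ≡ c * sumTo n f
  sumTo-*ˡ zero    c f = sym (*-zeroʳ c)
  sumTo-*ˡ (suc n) c f = trans (cong (_+ c * f n) (sumTo-*ˡ n c f)) (sym (*-distribˡ-+ c (sumTo n f) (f n)))

  sumTo-*ʳ : ∀ n c (f : ℕ → ℤ) → sumTo n (λ i → f i * c) ≡ sumTo n f * c
  sumTo-*ʳ n c f = trans (sumTo-cong n (λ i → *-comm (f i) c)) (trans (sumTo-*ˡ n c f) (*-comm c (sumTo n f)))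

  sumTo-comm : ∀ n m (F : ℕ → ℕ → ℤ) → sumTo n (λ i → sumTo m (F i)) ≡ sumTo m (λ j → sumTo n (λ i → F i j))
  sumTo-comm zero    m F = sym (sumTo-zero m)
    where
    sumTo-zero : ∀ m → sumTo m (λ _ → 0ℤ) ≡ 0ℤ
    sumTo-zero zero    = refl
    sumTo-zero (suc m) = cong (_+ 0ℤ) (sumTo-zero m)
  sumTo-comm (suc n) m F = trans (cong (_+ sumTo m (F n)) (sumTo-comm n m F))
    (sym (sumTo-+ m (λ j → sumTo n (λ i → F i j)) (F n)))

  sumTo-head : ∀ n (f : ℕ → ℤ) → sumTo (suc n) f ≡ f 0 + sumTo n (f ∘ suc)
  sumTo-head zero    f = trans (+-identityˡ (f 0)) (sym (+-identityʳ (f 0)))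
  sumTo-head (suc n) f = trans (cong (_+ f (suc n)) (sumTo-head n f)) (+-assoc (f 0) _ _)

  sumTo-rotate : ∀ n (f : ℕ → ℤ) → f n ≡ f 0 → sumTo n (f ∘ suc) ≡ sumTo n f
  sumTo-rotate n f fn≡f0 = ∙-cancelʳ (f 0) (sumTo n (f ∘ suc)) (sumTo n f) (begin
    sumTo n (f ∘ suc) + f 0  ≡⟨ +-comm (sumTo n (f ∘ suc)) (f 0) ⟩
    f 0 + sumTo n (f ∘ suc)  ≡⟨ sumTo-head n f ⟨
    sumTo n f + f n          ≡⟨ cong (λ u → sumTo n f + u) fn≡f0 ⟩
    sumTo n f + f 0          ∎)
    where open ≡-Reasoning

  sumTo-periodic : ∀ n (f : ℕ → ℤ) → (∀ i → f (i ℕ.+ n) ≡ f i) → ∀ k → sumTo n (λ i → f (k ℕ.+ i)) ≡ sumTo n f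
  sumTo-periodic n f periodic zero    = refl
  sumTo-periodic n f periodic (suc k) = trans (sumTo-periodic n (f ∘ suc) (periodic ∘ suc) k) (sumTo-rotate n f (periodic 0))

  sumTo-pairs : ∀ h (f : ℕ → ℤ) → sumTo (h ℕ.* 2) f ≡ sumTo h (λ j → f (j ℕ.* 2) + f (suc (j ℕ.* 2)))
  sumTo-pairs zero    f = refl
  sumTo-pairs (suc h) f = trans (+-assoc (sumTo (h ℕ.* 2) f) (f (h ℕ.* 2)) (f (suc (h ℕ.* 2))))
    (cong (_+ (f (h ℕ.* 2) + f (suc (h ℕ.* 2)))) (sumTo-pairs h f))

  sumTo-1 : ∀ n → sumTo n (λ _ → + 1) ≡ + n
  sumTo-1 zero    = refl
  sumTo-1 (suc n) = trans (cong (λ u → u + + 1) (sumTo-1 n)) (sym (trans (cong +_ (ℕ.+-comm 1 n)) (pos-+ n 1)))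

  sumTo-concentrated : ∀ n .{{_ : NonZero n}} {f : ℕ → ℤ} → (∀ s → 1 ℕ.≤ s → s ℕ.< n → f s ≡ 0ℤ) → sumTo n f ≡ f 0
  sumTo-concentrated 1               {f} _   = +-identityˡ (f 0)
  sumTo-concentrated (suc n@(suc _)) {f} f≡0 = trans
    (cong₂ _+_ (sumTo-concentrated n (λ s 1≤s s<n → f≡0 s 1≤s (ℕ.m<n⇒m<1+n s<n))) (f≡0 n (s≤s z≤n) ℕ.≤-refl))
    (+-identityʳ (f 0))

  at-periodic : ∀ {n} .{{_ : NonZero n}} (X : Seq n) i → at X (i ℕ.+ n) ≡ at X i
  at-periodic {n} X i = cong X (fromℕ<-cong _ _ ([m+n]%n≡m%n i n) (m%n<n (i ℕ.+ n) n) (m%n<n i n))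

  module _ {v : ℕ} .{{_ : NonZero v}} (X : Seq v) where

    PAF-0 : PM1 X → PAF X 0 ≡ + v
    PAF-0 ±1 = trans (sumTo-cong v λ k → trans (cong (λ u → at X k * at X u) (ℕ.+-identityʳ k)) (±1-square (±1 _)))
      (sumTo-1 v)
      where
      ±1-square : ∀ {x} → x ≡ + 1 ⊎ x ≡ - + 1 → x * x ≡ + 1
      ±1-square (inj₁ refl) = refl
      ±1-square (inj₂ refl) = refl

    PAF-reflect : ∀ s → s ℕ.≤ v → PAF X (v ℕ.∸ s) ≡ PAF X s
    PAF-reflect s s≤v = trans (sym (sumTo-periodic v g g-periodic s)) (sumTo-cong v g[s+k]≡)
      where
      g : ℕ → ℤ
      g k = at X k * at X (k ℕ.+ (v ℕ.∸ s))
      g-periodic : ∀ i → g (i ℕ.+ v) ≡ g i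
      g-periodic i = cong₂ _*_ (at-periodic X i)
        (trans (cong (at X) (swap-last i v (v ℕ.∸ s))) (at-periodic X (i ℕ.+ (v ℕ.∸ s))))
        where
        swap-last : ∀ a b c → a ℕ.+ b ℕ.+ c ≡ a ℕ.+ c ℕ.+ b
        swap-last a b c = trans (ℕ.+-assoc a b c) (trans (cong (a ℕ.+_) (ℕ.+-comm b c)) (sym (ℕ.+-assoc a c b)))
      g[s+k]≡ : ∀ k → g (s ℕ.+ k) ≡ at X k * at X (k ℕ.+ s)
      g[s+k]≡ k = trans (cong₂ _*_ (cong (at X) (ℕ.+-comm s k)) (trans (cong (at X) shift) (at-periodic X k)))
        (*-comm (at X (k ℕ.+ s)) (at X k))
        where
        shift : s ℕ.+ k ℕ.+ (v ℕ.∸ s) ≡ k ℕ.+ v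
        shift = trans (cong (ℕ._+ (v ℕ.∸ s)) (ℕ.+-comm s k)) (trans (ℕ.+-assoc k s (v ℕ.∸ s)) (cong (k ℕ.+_) (ℕ.m+[n∸m]≡n s≤v)))

  record Character (v : ℕ) (w : ℕ → ℤ) : Set where
    field
      homomorphic : ∀ a b → w (a ℕ.+ b) ≡ w a * w b
      square≡1    : ∀ a → w a * w a ≡ + 1
      periodic    : ∀ a → w (a ℕ.+ v) ≡ w a

    w0≡1 : w 0 ≡ + 1
    w0≡1 = trans (homomorphic 0 0) (square≡1 0)

  weightedSum : ∀ {v} .{{_ : NonZero v}} → (ℕ → ℤ) → Seq v → ℤ
  weightedSum {v} w X = sumTo v (λ i → w i * at X i)

  module _ {v : ℕ} .{{_ : NonZero v}} {w : ℕ → ℤ} (χ : Character v w) where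
    open Character χ

    -- With y i = w i * x i, the character turns w s * x k * x (k + s) into y k * y (k + s).
    Σ-character*PAF≡weightedSum² : ∀ (X : Seq v) →
      sumTo v (λ s → w s * PAF X s) ≡ weightedSum w X * weightedSum w X
    Σ-character*PAF≡weightedSum² X = begin
      sumTo v (λ s → w s * PAF X s)
        ≡⟨ sumTo-cong v (λ s → sumTo-*ˡ v (w s) (λ k → x k * x (k ℕ.+ s))) ⟨
      sumTo v (λ s → sumTo v (λ k → w s * (x k * x (k ℕ.+ s))))
        ≡⟨ sumTo-comm v v (λ s k → w s * (x k * x (k ℕ.+ s))) ⟩
      sumTo v (λ k → sumTo v (λ s → w s * (x k * x (k ℕ.+ s))))
        ≡⟨ sumTo-cong v (λ k → sumTo-cong v (λ s → weigh k s)) ⟩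
      sumTo v (λ k → sumTo v (λ s → y k * y (k ℕ.+ s)))
        ≡⟨ sumTo-cong v (λ k → sumTo-*ˡ v (y k) (λ s → y (k ℕ.+ s))) ⟩
      sumTo v (λ k → y k * sumTo v (λ s → y (k ℕ.+ s)))
        ≡⟨ sumTo-cong v (λ k → cong (y k *_) (sumTo-periodic v y y-periodic k)) ⟩
      sumTo v (λ k → y k * sumTo v y)
        ≡⟨ sumTo-*ʳ v (sumTo v y) y ⟩
      sumTo v y * sumTo v y
        ∎
      where
      open ≡-Reasoning
      x : ℕ → ℤ
      x = at X
      y : ℕ → ℤ
      y i = w i * x i
      y-periodic : ∀ i → y (i ℕ.+ v) ≡ y i
      y-periodic i = cong₂ _*_ (periodic i) (at-periodic X i)
      weigh : ∀ k s → w s * (x k * x (k ℕ.+ s)) ≡ y k * y (k ℕ.+ s)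
      weigh k s = begin
        w s * (x k * x (k ℕ.+ s))                  ≡⟨ *-identityˡ _ ⟨
        + 1 * (w s * (x k * x (k ℕ.+ s)))          ≡⟨ cong (_* (w s * (x k * x (k ℕ.+ s)))) (square≡1 k) ⟨
        w k * w k * (w s * (x k * x (k ℕ.+ s)))    ≡⟨ regroup (w k) (w s) (x k) (x (k ℕ.+ s)) ⟩
        w k * x k * (w k * w s * x (k ℕ.+ s))      ≡⟨ cong (λ u → y k * (u * x (k ℕ.+ s))) (homomorphic k s) ⟨
        y k * y (k ℕ.+ s)                          ∎
        where
        regroup : ∀ a b c d → a * a * (b * (c * d)) ≡ a * c * (a * b * d)
        regroup = solve-∀

  trivialCharacter : ∀ {v} → Character v (λ _ → + 1)
  trivialCharacter = record { homomorphic = λ _ _ → refl ; square≡1 = λ _ → refl ; periodic = λ _ → refl }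

  alternating : ℕ → ℤ
  alternating i = altSign i (+ 1)

  altSign-suc : ∀ i x → altSign (suc i) x ≡ - altSign i x
  altSign-suc zero          x = refl
  altSign-suc (suc zero)    x = sym (neg-involutive x)
  altSign-suc (suc (suc i)) x = altSign-suc i x

  alternating-+ : ∀ a b → alternating (a ℕ.+ b) ≡ alternating a * alternating b
  alternating-+ zero    b = sym (*-identityˡ (alternating b))
  alternating-+ (suc a) b = begin
    alternating (suc a ℕ.+ b)            ≡⟨ altSign-suc (a ℕ.+ b) (+ 1) ⟩
    - alternating (a ℕ.+ b)              ≡⟨ cong -_ (alternating-+ a b) ⟩
    - (alternating a * alternating b)    ≡⟨ neg-distribˡ-* (alternating a) (alternating b) ⟩
    - alternating a * alternating b      ≡⟨ cong (_* alternating b) (altSign-suc a (+ 1)) ⟨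
    alternating (suc a) * alternating b  ∎
    where open ≡-Reasoning

  alternating-square : ∀ a → alternating a * alternating a ≡ + 1
  alternating-square zero          = refl
  alternating-square (suc zero)    = refl
  alternating-square (suc (suc a)) = alternating-square a

  alternatingCharacter : ∀ h → Character (2 ℕ.* h) alternating
  alternatingCharacter h = record
    { homomorphic = alternating-+
    ; square≡1    = alternating-square
    ; periodic    = λ a → begin
        alternating (a ℕ.+ 2 ℕ.* h)               ≡⟨ alternating-+ a (2 ℕ.* h) ⟩
        alternating a * alternating (2 ℕ.* h)     ≡⟨ cong (λ u → alternating a * u) alternating-2h ⟩
        alternating a * + 1                       ≡⟨ *-identityʳ (alternating a) ⟩
        alternating a                             ∎
    }
    where
    open ≡-Reasoning
    alternating-2h : alternating (2 ℕ.* h) ≡ + 1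
    alternating-2h = trans (cong alternating (cong (h ℕ.+_) (ℕ.+-identityʳ h)))
      (trans (alternating-+ h h) (alternating-square h))

  module _ {h : ℕ} .{{_ : NonZero (2 ℕ.* h)}} (X : Seq (2 ℕ.* h)) where

    weightedSum-2-periodic : ∀ (w : ℕ → ℤ) → (∀ i → w (2 ℕ.+ i) ≡ w i) →
      weightedSum w X ≡ w 0 * compress h 2 X 0F + w 1 * compress h 2 X 1F
    weightedSum-2-periodic w w-periodic = begin
      sumTo (2 ℕ.* h) F
        ≡⟨ cong (λ n → sumTo n F) (ℕ.*-comm 2 h) ⟩
      sumTo (h ℕ.* 2) F
        ≡⟨ sumTo-pairs h F ⟩
      sumTo h (λ j → F (j ℕ.* 2) + F (suc (j ℕ.* 2)))
        ≡⟨ sumTo-cong h (λ j → cong₂ (λ u u′ → u * at X (j ℕ.* 2) + u′ * at X (suc (j ℕ.* 2))) (w-even j) (w-odd j)) ⟩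
      sumTo h (λ j → w 0 * at X (j ℕ.* 2) + w 1 * at X (suc (j ℕ.* 2)))
        ≡⟨ sumTo-+ h (λ j → w 0 * at X (j ℕ.* 2)) (λ j → w 1 * at X (suc (j ℕ.* 2))) ⟩
      sumTo h (λ j → w 0 * at X (j ℕ.* 2)) + sumTo h (λ j → w 1 * at X (suc (j ℕ.* 2)))
        ≡⟨ cong₂ _+_ (sumTo-*ˡ h (w 0) (λ j → at X (j ℕ.* 2))) (sumTo-*ˡ h (w 1) (λ j → at X (suc (j ℕ.* 2)))) ⟩
      w 0 * compress h 2 X 0F + w 1 * compress h 2 X (1F)
        ∎
      where
      open ≡-Reasoning
      F : ℕ → ℤ
      F i = w i * at X i
      w-even : ∀ j → w (j ℕ.* 2) ≡ w 0
      w-even zero    = refl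
      w-even (suc j) = trans (w-periodic (j ℕ.* 2)) (w-even j)
      w-odd : ∀ j → w (suc (j ℕ.* 2)) ≡ w 1
      w-odd zero    = refl
      w-odd (suc j) = trans (w-periodic (suc (j ℕ.* 2))) (w-odd j)

    weightedSum-trivial : weightedSum (λ _ → + 1) X ≡ compress h 2 X 0F + compress h 2 X 1F
    weightedSum-trivial = trans (weightedSum-2-periodic (λ _ → + 1) (λ _ → refl))
      (cong₂ _+_ (*-identityˡ (compress h 2 X 0F)) (*-identityˡ (compress h 2 X 1F)))

    weightedSum-alternating : weightedSum alternating X ≡ compress h 2 X 0F - compress h 2 X 1F
    weightedSum-alternating = trans (weightedSum-2-periodic alternating (λ _ → refl))
      (signs (compress h 2 X 0F) (compress h 2 X 1F))
      where
      signs : ∀ x y → + 1 * x + - + 1 * y ≡ x - y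
      signs = solve-∀

    total≡compress₀+compress₁ : total X ≡ compress h 2 X 0F + compress h 2 X 1F
    total≡compress₀+compress₁ =
      trans (sumTo-cong (2 ℕ.* h) (λ i → sym (*-identityˡ (at X i)))) weightedSum-trivial

  module _ {h : ℕ} .{{_ : NonZero (2 ℕ.* h)}} {A B : Seq (2 ℕ.* h)} (golay : PeriodicGolayPair h A B) where

    private
      v : ℕ
      v = 2 ℕ.* h
      ±1-A : PM1 A
      ±1-A = proj₁ golay
      ±1-B : PM1 B
      ±1-B = proj₁ (proj₂ golay)
      golay-condition : ∀ s → 1 ℕ.≤ s → s ℕ.≤ h → PAF A s + PAF B s ≡ 0ℤ
      golay-condition = proj₂ (proj₂ golay)

    golay-PAF+PAF≡0 : ∀ s → 1 ℕ.≤ s → s ℕ.< v → PAF A s + PAF B s ≡ 0ℤ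
    golay-PAF+PAF≡0 s 1≤s s<v with s ℕ.≤? h
    ... | yes s≤h = golay-condition s 1≤s s≤h
    ... | no  s≰h = trans (sym (cong₂ _+_ (PAF-reflect A s s≤v) (PAF-reflect B s s≤v)))
                          (golay-condition (v ℕ.∸ s) (ℕ.m<n⇒0<n∸m s<v) v∸s≤h)
      where
      s≤v : s ℕ.≤ v
      s≤v = ℕ.<⇒≤ s<v
      v∸s≤h : v ℕ.∸ s ℕ.≤ h
      v∸s≤h = ℕ.≤-trans (ℕ.∸-monoʳ-≤ v (ℕ.<⇒≤ (ℕ.≰⇒> s≰h)))
        (ℕ.≤-reflexive (trans (ℕ.m+n∸m≡n h (h ℕ.+ 0)) (ℕ.+-identityʳ h)))

    golay-weightedSums : ∀ {w} → Character v w →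
      weightedSum w A * weightedSum w A + weightedSum w B * weightedSum w B ≡ + (2 ℕ.* v)
    golay-weightedSums {w} χ = begin
      weightedSum w A * weightedSum w A + weightedSum w B * weightedSum w B
        ≡⟨ cong₂ _+_ (Σ-character*PAF≡weightedSum² χ A) (Σ-character*PAF≡weightedSum² χ B) ⟨
      sumTo v (λ s → w s * PAF A s) + sumTo v (λ s → w s * PAF B s)
        ≡⟨ sumTo-+ v (λ s → w s * PAF A s) (λ s → w s * PAF B s) ⟨
      sumTo v (λ s → w s * PAF A s + w s * PAF B s)
        ≡⟨ sumTo-cong v (λ s → *-distribˡ-+ (w s) (PAF A s) (PAF B s)) ⟨
      sumTo v (λ s → w s * (PAF A s + PAF B s))
        ≡⟨ sumTo-concentrated v (λ s 1≤s s<v → trans (cong (w s *_) (golay-PAF+PAF≡0 s 1≤s s<v)) (*-zeroʳ (w s))) ⟩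
      w 0 * (PAF A 0 + PAF B 0)
        ≡⟨ cong₂ _*_ (Character.w0≡1 χ) (cong₂ _+_ (PAF-0 A ±1-A) (PAF-0 B ±1-B)) ⟩
      + 1 * (+ v + + v)
        ≡⟨ *-identityˡ (+ v + + v) ⟩
      + v + + v
        ≡⟨ pos-+ v v ⟨
      + (v ℕ.+ v)
        ≡⟨ cong (λ u → + (v ℕ.+ u)) (ℕ.+-identityʳ v) ⟨
      + (2 ℕ.* v)
        ∎
      where open ≡-Reasoning

    golay-compression-sums : let a₀ = compress h 2 A 0F ; a₁ = compress h 2 A 1F
                                 b₀ = compress h 2 B 0F ; b₁ = compress h 2 B 1F in
      (a₀ + a₁) * (a₀ + a₁) + (b₀ + b₁) * (b₀ + b₁) ≡ + (2 ℕ.* v)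
    golay-compression-sums = subst₂ (λ x y → x * x + y * y ≡ + (2 ℕ.* v))
      (weightedSum-trivial {h} A) (weightedSum-trivial {h} B) (golay-weightedSums trivialCharacter)

    golay-compression-differences : let a₀ = compress h 2 A 0F ; a₁ = compress h 2 A 1F
                                        b₀ = compress h 2 B 0F ; b₁ = compress h 2 B 1F in
      (a₀ - a₁) * (a₀ - a₁) + (b₀ - b₁) * (b₀ - b₁) ≡ + (2 ℕ.* v)
    golay-compression-differences = subst₂ (λ x y → x * x + y * y ≡ + (2 ℕ.* v))
      (weightedSum-alternating {h} A) (weightedSum-alternating {h} B)
      (golay-weightedSums (alternatingCharacter h))

module LengthTwo where

  open import Defs
  open import Data.Nat.Base as ℕ using (ℕ)
  import Data.Nat.Properties as ℕ
  open import Data.Nat.DivMod using (m*n/n≡m; m*n%n≡0)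
  open import Data.Fin.Base using (toℕ)
  open import Data.Fin.Patterns using (0F; 1F)
  open import Data.Integer.Base using (ℤ; +_; -[1+_]; -_; _+_; _-_; _*_; _/ℕ_)
  open import Data.Integer.Properties using (pos-*; +-comm; +-inverseʳ)
  open import Data.Integer.Tactic.RingSolver using (solve-∀)
  open import Data.Product.Base using (_,_)
  open import Data.Sum.Base as Sum using (_⊎_; inj₁; inj₂)
  open import Relation.Binary.PropositionalEquality
  open import Relation.Binary.Construct.Closure.ReflexiveTransitive using (ε; _◅_)
  open import Relation.Binary.Construct.Closure.Symmetric using (fwd)
  open SumsOfTwoSquares using (TwoSquaresUnique; i*i≡j*j⇒i≡±j; i+j≡k+l∧i≡k⇒j≡l)

  [i*2]/2≡i : ∀ i → (i * + 2) /ℕ 2 ≡ i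
  [i*2]/2≡i (+ n) rewrite sym (pos-* n 2) = cong +_ (m*n/n≡m n 2)
  [i*2]/2≡i -[1+ n ] rewrite m*n%n≡0 (ℕ.suc n) 2 {{_}} | m*n/n≡m (ℕ.suc n) 2 {{_}} = refl

  halve : ∀ {i} j → i ≡ j * + 2 → i /ℕ 2 ≡ j
  halve j i≡2j = trans (cong (_/ℕ 2) i≡2j) ([i*2]/2≡i j)

  data Rotation (X : Seq 2) (x y : ℤ) : Set where
    identity : x ≡ X 0F → y ≡ X 1F → Rotation X x y
    swapped  : x ≡ X 1F → y ≡ X 0F → Rotation X x y

  rotation-swap : ∀ {X x y} → Rotation X x y → Rotation X y x
  rotation-swap (identity x≡ y≡) = swapped y≡ x≡
  rotation-swap (swapped x≡ y≡)  = identity y≡ x≡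

  rotations⇒equivalent : ∀ {X Y x y x′ y′} → Rotation X x y → Rotation Y x′ y′ →
    Equivalent (X , Y) (seq2 x y , seq2 x′ y′)
  rotations⇒equivalent rX rY =
    fwd (shift₁ (offset rX) (rotate rX) (λ _ → refl)) ◅ fwd (shift₂ (offset rY) (λ _ → refl) (rotate rY)) ◅ ε
    where
    offset : ∀ {Z x y} → Rotation Z x y → ℕ
    offset (identity _ _) = 0
    offset (swapped _ _)  = 1
    rotate : ∀ {Z x y} (r : Rotation Z x y) i → seq2 x y i ≡ at Z (toℕ i ℕ.+ offset r)
    rotate (identity x≡ _) 0F = x≡
    rotate (identity _ y≡) 1F = y≡
    rotate (swapped x≡ _)  0F = x≡
    rotate (swapped _ y≡)  1F = y≡

  rotation-halves : ∀ (X : Seq 2) s → (X 0F - X 1F) * (X 0F - X 1F) ≡ s * s →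
    Rotation X ((X 0F + X 1F + s) /ℕ 2) ((X 0F + X 1F - s) /ℕ 2)
  rotation-halves X s d²≡s² with i*i≡j*j⇒i≡±j s (X 0F - X 1F) (sym d²≡s²)
  ... | inj₁ refl = identity (halve _ (identity₁ (X 0F) (X 1F))) (halve _ (identity₂ (X 0F) (X 1F)))
    where
    identity₁ : ∀ x y → x + y + (x - y) ≡ x * + 2
    identity₁ = solve-∀
    identity₂ : ∀ x y → x + y - (x - y) ≡ y * + 2
    identity₂ = solve-∀
  ... | inj₂ refl = swapped (halve _ (identity₁ (X 0F) (X 1F))) (halve _ (identity₂ (X 0F) (X 1F)))
    where
    identity₁ : ∀ x y → x + y + - (x - y) ≡ y * + 2
    identity₁ = solve-∀
    identity₂ : ∀ x y → x + y - - (x - y) ≡ x * + 2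
    identity₂ = solve-∀

  rotation-zero : ∀ (X : Seq 2) → (X 0F - X 1F) * (X 0F - X 1F) ≡ (X 0F + X 1F) * (X 0F + X 1F) →
    Rotation X (+ 0) (X 0F + X 1F)
  rotation-zero X d²≡a² = rotation-swap (subst₂ (Rotation X) (halve a (double a)) (cong (_/ℕ 2) (+-inverseʳ a))
    (rotation-halves X a d²≡a²))
    where
    a = X 0F + X 1F
    double : ∀ a → a + a ≡ a * + 2
    double = solve-∀

  compressions-classified : ∀ {n} (X Y : Seq 2) → TwoSquaresUnique n →
    let a = X 0F + X 1F ; b = Y 0F + Y 1F ; c = X 0F - X 1F ; d = Y 0F - Y 1F in
    a * a + b * b ≡ + n → c * c + d * d ≡ + n →
    Equivalent (X , Y) (seq2 (+ 0) a , seq2 (+ 0) b)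
    ⊎ Equivalent (X , Y) (seq2 ((a + b) /ℕ 2) ((a - b) /ℕ 2) , seq2 ((a + b) /ℕ 2) ((b - a) /ℕ 2))
  compressions-classified X Y unique a²+b²≡n c²+d²≡n =
    Sum.map c²≡a²⇒zeroes c²≡b²⇒halves (unique a b c d a²+b²≡n c²+d²≡n)
    where
    a b c d : ℤ
    a = X 0F + X 1F
    b = Y 0F + Y 1F
    c = X 0F - X 1F
    d = Y 0F - Y 1F
    c²+d²≡a²+b² : c * c + d * d ≡ a * a + b * b
    c²+d²≡a²+b² = trans c²+d²≡n (sym a²+b²≡n)
    c²≡a²⇒zeroes : c * c ≡ a * a → Equivalent (X , Y) (seq2 (+ 0) a , seq2 (+ 0) b)
    c²≡a²⇒zeroes c²≡a² = rotations⇒equivalent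
      (rotation-zero X c²≡a²) (rotation-zero Y (i+j≡k+l∧i≡k⇒j≡l c²+d²≡a²+b² c²≡a²))
    c²≡b²⇒halves : c * c ≡ b * b →
      Equivalent (X , Y) (seq2 ((a + b) /ℕ 2) ((a - b) /ℕ 2) , seq2 ((a + b) /ℕ 2) ((b - a) /ℕ 2))
    c²≡b²⇒halves c²≡b² = rotations⇒equivalent (rotation-halves X b c²≡b²)
      (subst (λ t → Rotation Y (t /ℕ 2) ((b - a) /ℕ 2)) (+-comm b a)
        (rotation-halves Y a (i+j≡k+l∧i≡k⇒j≡l (trans c²+d²≡a²+b² (+-comm (a * a) (b * b))) c²≡b²)))

open import Defs
open import Data.Nat using (ℕ; suc; NonZero; _^_; _%_)
open import Data.Nat.Divisibility using (_∣_)
open import Data.Nat.Primality using (Prime)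
open import Data.Integer using (ℤ; _+_; _-_; _/ℕ_; +_)
open import Data.Product using (_×_; _,_; ∃)
open import Data.Sum using (_⊎_)
open import Relation.Nullary using (¬_)
open import Relation.Binary.PropositionalEquality using (_≡_)
open SplitPart
open SumsOfTwoSquares
open Autocorrelation
open LengthTwo

mainTheorem5 : (h : ℕ) → .{{_ : NonZero h}} → .{{_ : NonZero (2 Data.Nat.* h)}} →
    (A B : Seq (2 Data.Nat.* h)) → PeriodicGolayPair h A B →
    ((∀ p → Prime p → p % 4 ≡ 1 → ¬ (p ∣ h))
      ⊎ ∃ (λ p → Prime p × p % 4 ≡ 1 × p ∣ h × ¬ (p ^ 2 ∣ h)
          × (∀ q → Prime q → q % 4 ≡ 1 → q ∣ h → q ≡ p))) →
    Equivalent (compress h 2 A , compress h 2 B) (seq2 (+ 0) (total A) , seq2 (+ 0) (total B))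
    ⊎ Equivalent (compress h 2 A , compress h 2 B)
        (seq2 ((total A + total B) /ℕ 2) ((total A - total B) /ℕ 2)
         , seq2 ((total A + total B) /ℕ 2) ((total B - total A) /ℕ 2))
mainTheorem5 h A B golay hypothesis
  rewrite total≡compress₀+compress₁ {h} A | total≡compress₀+compress₁ {h} B =
  compressions-classified (compress h 2 A) (compress h 2 B)
    (splitPartOneOrPrime⇒twoSquaresUnique _
      (splitPartOneOrPrime-2* (splitPartOneOrPrime-2* (splitPartOneOrPrime-fromHypothesis hypothesis))))
    (golay-compression-sums golay) (golay-compression-differences golay)
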